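{- Consider peg solitaire on Wiegleb's 45-hole board. Start with a man in every hole except g4. Then there is a legal sequence of moves that ends with a single man at d4, in which the last move is the 16-jump sweep by one man along the path d4-d2-f2-f4-h4-h6-f6-f8-d8-d6-b6-b4-d4-f4-f6-d6-d4.
   Context: Wiegleb's board has columns labelled a–i and rows numbered 1–9. Its holes are all holes in columns d, e, f (rows 1–9) together with all holes in rows 4, 5, 6 (columns a–i), 45 holes in total. Peg solitaire rules: each hole is either empty or holds one man. A jump takes a man from a hole X over an orthogonally adjacent occupied hole Y into the empty hole Z immediately beyond Y on the same line; the man at Y is removed. A jump is written X-Z. A move is a sequence of one or more consecutive jumps made by the same man, written X-Z-W-...; a move with k jumps is a k-sweep. -}

module Defs where

open import Data.Nat using (ℕ; _≤ᵇ_)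
open import Data.Fin using (Fin; toℕ; #_)
open import Data.Fin.Properties using () renaming (_≟_ to _≟F_)
open import Data.Bool using (Bool; true; false; _∧_; _∨_; not; if_then_else_; T)
open import Data.Product using (_×_; _,_; Σ; ∃; ∃-syntax)
open import Data.List using (List; []; _∷_)
open import Relation.Nullary.Decidable using (⌊_⌋)
open import Relation.Binary.PropositionalEquality using (_≡_)
open import Relation.Binary.Construct.Closure.ReflexiveTransitive using (Star)

-- A hole is (column , row), 0-indexed: column a = 0, ..., i = 8;
-- row 1 = 0, ..., row 9 = 8.
Hole : Set
Hole = Fin 9 × Fin 9

mid : Fin 9 → Bool
mid i = (3 ≤ᵇ toℕ i) ∧ (toℕ i ≤ᵇ 5)

onBoard : Hole → Bool
onBoard (c , r) = mid c ∨ mid r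

OnBoard : Hole → Set
OnBoard h = T (onBoard h)

_==_ : Hole → Hole → Bool
(c , r) == (c' , r') = ⌊ c ≟F c' ⌋ ∧ ⌊ r ≟F r' ⌋

-- A position: true = hole holds a man (values off the board are irrelevant).
Position : Set
Position = Hole → Bool

data Line : Hole → Hole → Hole → Set where
  horiz-inc : ∀ {a b c r} → toℕ b ≡ ℕ.suc (toℕ a) → toℕ c ≡ ℕ.suc (toℕ b) →
              Line (a , r) (b , r) (c , r)
  horiz-dec : ∀ {a b c r} → toℕ b ≡ ℕ.suc (toℕ a) → toℕ c ≡ ℕ.suc (toℕ b) →
              Line (c , r) (b , r) (a , r)
  vert-inc  : ∀ {a b c k} → toℕ b ≡ ℕ.suc (toℕ a) → toℕ c ≡ ℕ.suc (toℕ b) →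
              Line (k , a) (k , b) (k , c)
  vert-dec  : ∀ {a b c k} → toℕ b ≡ ℕ.suc (toℕ a) → toℕ c ≡ ℕ.suc (toℕ b) →
              Line (k , c) (k , b) (k , a)

afterJump : Position → Hole → Hole → Hole → Position
afterJump p X Y Z h =
  if h == Z then true else (if (h == X) ∨ (h == Y) then false else p h)

data Jumps (p : Position) (X : Hole) : List Hole → Position → Set where
  done : Jumps p X [] p
  jump : ∀ {Y Z zs q} → Line X Y Z →
         OnBoard X → OnBoard Y → OnBoard Z →
         p X ≡ true → p Y ≡ true → p Z ≡ false →
         Jumps (afterJump p X Y Z) Z zs q →
         Jumps p X (Z ∷ zs) q

Move : Position → Position → Set
Move p q = Σ Hole λ X → Σ Hole λ Z → Σ (List Hole) λ zs → Jumps p X (Z ∷ zs) q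

Moves : Position → Position → Set
Moves = Star Move

d2 d4 d6 d8 f2 f4 f6 f8 h4 h6 b4 b6 g4 : Hole
b4 = (# 1 , # 3)
b6 = (# 1 , # 5)
d2 = (# 3 , # 1)
d4 = (# 3 , # 3)
d6 = (# 3 , # 5)
d8 = (# 3 , # 7)
f2 = (# 5 , # 1)
f4 = (# 5 , # 3)
f6 = (# 5 , # 5)
f8 = (# 5 , # 7)
g4 = (# 6 , # 3)
h4 = (# 7 , # 3)
h6 = (# 7 , # 5)

initial : Position
initial h = not (h == g4)

SingleManAt : Hole → Position → Set
SingleManAt H p = ∀ h → OnBoard h → p h ≡ (h == H)

finalPath : List Hole
finalPath = d2 ∷ f2 ∷ f4 ∷ h4 ∷ h6 ∷ f6 ∷ f8 ∷ d8 ∷ d6 ∷ b6 ∷ b4 ∷ d4 ∷ f4 ∷ f6 ∷ d6 ∷ d4 ∷ []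

{-# OPTIONS --safe #-}
-- The play is exhibited explicitly: 27 single jumps reduce the 44 men to the 17
-- needed by the final sweep. Each move is replayed by a checker that returns a
-- jump derivation when the move is legal, so the proof consists of the play
-- itself; an illegal move would make from-just fail to typecheck.
module Submission where

open import Defs
open import Data.Nat using (ℕ)
open import Data.Bool using (true; false; T?)
open import Data.Bool.Properties using () renaming (_≟_ to _≟B_)
open import Data.Fin using (Fin; #_; zero; suc; toℕ)
open import Data.Fin.Properties using (all?) renaming (_≟_ to _≟F_)
open import Data.List using (List; []; _∷_)
open import Data.Maybe using (Maybe; just; nothing; _<∣>_; from-just)
import Data.Maybe as Maybe
open import Data.Product using (Σ; _×_; _,_; proj₁; proj₂)
open import Relation.Binary.PropositionalEquality using (_≡_; refl; cong)
open import Relation.Binary.Construct.Closure.ReflexiveTransitive using (ε; _◅_)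
open import Relation.Nullary using (Dec; yes; no)
open import Relation.Nullary.Decidable using (_×-dec_; _→-dec_; map′; from-yes)

Consecutive : ∀ {n} → Fin n → Fin n → Fin n → Set
Consecutive a b c = toℕ b ≡ ℕ.suc (toℕ a) × toℕ c ≡ ℕ.suc (toℕ b)

between : ∀ {n} (a c : Fin n) → Maybe (Σ (Fin n) λ b → Consecutive a b c)
between zero    (suc (suc zero)) = just (suc zero , refl , refl)
between (suc a) (suc c)          =
  Maybe.map (λ { (b , ab , bc) → suc b , cong ℕ.suc ab , cong ℕ.suc bc }) (between a c)
between _       _                = nothing

jumpedHole : (X Z : Hole) → Maybe (Σ Hole λ Y → Line X Y Z)
jumpedHole (a , r) (c , s) = alongRow (r ≟F s) <∣> alongColumn (a ≟F c)
  where
  alongRow : Dec (r ≡ s) → Maybe (Σ Hole λ Y → Line (a , r) Y (c , s))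
  alongRow (yes refl) =
    Maybe.map (λ { (b , ab , bc) → (b , r) , horiz-inc ab bc }) (between a c)
    <∣> Maybe.map (λ { (b , cb , ba) → (b , r) , horiz-dec cb ba }) (between c a)
  alongRow (no _) = nothing

  alongColumn : Dec (a ≡ c) → Maybe (Σ Hole λ Y → Line (a , r) Y (c , s))
  alongColumn (yes refl) =
    Maybe.map (λ { (b , rb , bs) → (a , b) , vert-inc rb bs }) (between r s)
    <∣> Maybe.map (λ { (b , sb , br) → (a , b) , vert-dec sb br }) (between s r)
  alongColumn (no _) = nothing

findJumps : (p : Position) (X : Hole) (zs : List Hole) → Maybe (Σ Position (Jumps p X zs))
findJumps p X []       = just (p , done)
findJumps p X (Z ∷ zs) with jumpedHole X Z
... | nothing = nothing
... | just (Y , line)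
  with T? (onBoard X) ×-dec T? (onBoard Y) ×-dec T? (onBoard Z)
       ×-dec p X ≟B true ×-dec p Y ≟B true ×-dec p Z ≟B false
... | no _ = nothing
... | yes (x , y , z , px , py , pz) =
  Maybe.map (λ { (q , js) → q , jump line x y z px py pz js })
            (findJumps (afterJump p X Y Z) Z zs)

findMoves : (p : Position) → List (List Hole) → Maybe (Σ Position (Moves p))
findMoves p []                     = just (p , ε)
findMoves p ((X ∷ Z ∷ zs) ∷ moves) with findJumps p X (Z ∷ zs)
... | nothing       = nothing
... | just (q , js) =
  Maybe.map (λ { (r , ms) → r , (X , Z , zs , js) ◅ ms }) (findMoves q moves)
findMoves p (_ ∷ _)                = nothing

singleManAt? : (H : Hole) (p : Position) → Dec (SingleManAt H p)
singleManAt? H p =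
  map′ (λ all (c , r) → all c r) (λ single c r → single (c , r))
       (all? λ c → all? λ r → T? (onBoard (c , r)) →-dec p (c , r) ≟B ((c , r) == H))

a4 a6 c4 c6 d1 d3 d5 d7 d9 e2 e4 f1 f5 f7 f9 h5 i4 i6 : Hole
a4 = (# 0 , # 3)
a6 = (# 0 , # 5)
c4 = (# 2 , # 3)
c6 = (# 2 , # 5)
d1 = (# 3 , # 0)
d3 = (# 3 , # 2)
d5 = (# 3 , # 4)
d7 = (# 3 , # 6)
d9 = (# 3 , # 8)
e2 = (# 4 , # 1)
e4 = (# 4 , # 3)
f1 = (# 5 , # 0)
f5 = (# 5 , # 4)
f7 = (# 5 , # 6)
f9 = (# 5 , # 8)
h5 = (# 7 , # 4)
i4 = (# 8 , # 3)
i6 = (# 8 , # 5)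

_─_ : Hole → Hole → List Hole
X ─ Z = X ∷ Z ∷ []

opening : List (List Hole)
opening =
  i4 ─ g4 ∷ i6 ─ i4 ∷ h6 ─ h4 ∷ f5 ─ h5 ∷ d5 ─ f5 ∷ d3 ─ d5 ∷ d1 ─ d3 ∷
  f2 ─ d2 ∷ e4 ─ e2 ∷ g4 ─ e4 ∷ i4 ─ g4 ∷ d6 ─ d4 ∷ d8 ─ d6 ∷ f7 ─ d7 ∷
  f9 ─ f7 ∷ f6 ─ f8 ∷ d9 ─ f9 ∷ f9 ─ f7 ∷ f1 ─ d1 ∷ d3 ─ d5 ∷ b4 ─ d4 ∷
  c6 ─ c4 ∷ a6 ─ c6 ∷ d6 ─ b6 ∷ d1 ─ d3 ∷ a4 ─ a6 ∷ a6 ─ c6 ∷ []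

openingPlay : Σ Position (Moves initial)
openingPlay = from-just (findMoves initial opening)

finalSweep : Σ Position (Jumps (proj₁ openingPlay) d4 finalPath)
finalSweep = from-just (findJumps (proj₁ openingPlay) d4 finalPath)

mainTheorem2 : Σ Position λ p → Σ Position λ q →
    Moves initial p × Jumps p d4 finalPath q × SingleManAt d4 q
mainTheorem2 =
  proj₁ openingPlay , proj₁ finalSweep , proj₂ openingPlay , proj₂ finalSweep ,
  from-yes (singleManAt? d4 (proj₁ finalSweep))
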